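{- Let $a_1>a_2>\cdots>a_k\ge 1$ and $r_1,\ldots,r_k\ge1$ be integers, and let $G=S_{(a_1^{r_1},\ldots,a_k^{r_k})}$. Then \[\mathrm{sn}(G)=\max_{1\le \ell\le k}\min\left\{a_\ell,\ 1+\sum_{i=1}^{\ell} r_i\right\}.\]
   Context: Graphs are finite, connected, loopless multigraphs. A banana star is a multigraph whose underlying simple graph is a star: a center $v_0$ adjacent to all other vertices (leaves), with no two leaves adjacent. For distinct integers $a_1>\cdots>a_k\ge1$ and positive integers $r_i$, $S_{(a_1^{r_1},\ldots,a_k^{r_k})}$ denotes the banana star in which, for each $i$, exactly $r_i$ leaves are joined to $v_0$ by exactly $a_i$ edges (and there are no other leaves). A scramble on $G$ is a finite collection of nonempty vertex sets (eggs), each inducing a connected subgraph. Its hitting number is the minimum size of a vertex set meeting every egg. An egg-cut is a set $T$ of edges such that deleting $T$ leaves at least two connected components each completely containing some egg; the egg-cut number is the minimum size of an egg-cut ($\infty$ if none exists). The order of a scramble is the minimum of its hitting number and egg-cut number, and the scramble number $\mathrm{sn}(G)$ is the maximum order of a scramble on $G$. -}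

module Defs where

open import Data.Nat using (ℕ; zero; suc; _+_; _≤_; _<_; _⊓_; _⊔_)
open import Data.Fin as Fin using (Fin; toℕ)
open import Data.Fin.Subset using (Subset; _∈_; _∉_; ∣_∣)
open import Data.Nat.ListAction using (sum)
open import Data.List using (List; []; _∷_; length; map; allFin; concat; replicate; filter; foldr; lookup; tabulate)
open import Data.List.Relation.Unary.All using (All)
import Data.List.Membership.Propositional as LM
open import Data.Maybe using (Maybe; just; nothing)
open import Data.Product using (Σ; ∃; ∃-syntax; _×_; _,_; proj₁; proj₂)
open import Data.Sum using (_⊎_)
open import Data.Vec.Functional using (Vector)
open import Relation.Binary.PropositionalEquality using (_≡_)
open import Relation.Nullary using (¬_)

-- Multigraphs: vertex set Fin n, and an explicit list of edges
-- (each edge a pair of endpoints; parallel edges = repeated entries).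

record Multigraph : Set where
  field
    n     : ℕ
    edges : List (Fin n × Fin n)

  m : ℕ
  m = length edges

  endpoints : Fin m → Fin n × Fin n
  endpoints = lookup edges

open Multigraph public

VertexSet : Multigraph → Set
VertexSet G = Subset (n G)

EdgeSet : Multigraph → Set
EdgeSet G = Subset (m G)

Joins : (G : Multigraph) → Fin (m G) → Fin (n G) → Fin (n G) → Set
Joins G e u w =
  (proj₁ (endpoints G e) ≡ u × proj₂ (endpoints G e) ≡ w) ⊎
  (proj₁ (endpoints G e) ≡ w × proj₂ (endpoints G e) ≡ u)

data Walk (G : Multigraph) (keep : Fin (m G) → Set) (inW : Fin (n G) → Set)
          : Fin (n G) → Fin (n G) → Set where
  here : ∀ {u} → inW u → Walk G keep inW u u
  step : ∀ {u w v} (e : Fin (m G)) → keep e → Joins G e u w → inW u →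
         Walk G keep inW w v → Walk G keep inW u v

AllEdges : (G : Multigraph) → Fin (m G) → Set
AllEdges G e = e ≡ e

AllVertices : (G : Multigraph) → Fin (n G) → Set
AllVertices G v = v ≡ v

Connected : Multigraph → Set
Connected G = ∀ u v → Walk G (AllEdges G) (AllVertices G) u v

Loopless : Multigraph → Set
Loopless G = ∀ e u → ¬ Joins G e u u

IsEgg : (G : Multigraph) → VertexSet G → Set
IsEgg G E = (∃[ x ] x ∈ E) ×
            (∀ x y → x ∈ E → y ∈ E → Walk G (AllEdges G) (λ z → z ∈ E) x y)

record Scramble (G : Multigraph) : Set where
  field
    eggs   : List (VertexSet G)
    isEggs : All (IsEgg G) eggs
open Scramble public

Hits : (G : Multigraph) → Scramble G → VertexSet G → Set
Hits G S H = All (λ E → ∃[ x ] (x ∈ H × x ∈ E)) (eggs S)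

IsMin : (ℕ → Set) → ℕ → Set
IsMin P k = P k × (∀ j → P j → k ≤ j)

IsMax : (ℕ → Set) → ℕ → Set
IsMax P k = P k × (∀ j → P j → j ≤ k)

HittingNumber : (G : Multigraph) → Scramble G → ℕ → Set
HittingNumber G S = IsMin (λ j → ∃[ H ] (Hits G S H × ∣ H ∣ ≡ j))

SameComp : (G : Multigraph) → EdgeSet G → Fin (n G) → Fin (n G) → Set
SameComp G T x y = Walk G (λ e → e ∉ T) (AllVertices G) x y

IsEggCut : (G : Multigraph) → Scramble G → EdgeSet G → Set
IsEggCut G S T =
  Σ (VertexSet G) λ E₁ → Σ (VertexSet G) λ E₂ →
    E₁ LM.∈ eggs S × E₂ LM.∈ eggs S ×
    (∀ x y → x ∈ E₁ → y ∈ E₁ → SameComp G T x y) ×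
    (∀ x y → x ∈ E₂ → y ∈ E₂ → SameComp G T x y) ×
    (∀ x y → x ∈ E₁ → y ∈ E₂ → ¬ SameComp G T x y)

-- egg-cut number, with `nothing` standing for ∞ (no egg-cut exists)
EggCutNumber : (G : Multigraph) → Scramble G → Maybe ℕ → Set
EggCutNumber G S (just c) = IsMin (λ j → ∃[ T ] (IsEggCut G S T × ∣ T ∣ ≡ j)) c
EggCutNumber G S nothing  = ¬ (∃[ T ] IsEggCut G S T)

min∞ : ℕ → Maybe ℕ → ℕ
min∞ h (just c) = h ⊓ c
min∞ h nothing  = h

Order : (G : Multigraph) → Scramble G → ℕ → Set
Order G S o = ∃[ h ] ∃[ c ] (HittingNumber G S h × EggCutNumber G S c × o ≡ min∞ h c)

ScrambleNumber : Multigraph → ℕ → Set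
ScrambleNumber G = IsMax (λ o → ∃[ S ] Order G S o)

-- Banana stars S_(a_1^{r_1},...,a_k^{r_k}), with a, r : Fin k → ℕ
-- (index i : Fin k corresponds to i+1 in the paper).

leafMults : (k : ℕ) → Vector ℕ k → Vector ℕ k → List ℕ
leafMults k a r = concat (tabulate {n = k} (λ i → replicate (r i) (a i)))

-- vertex 0 is the center v₀; vertex suc j is the j-th leaf, joined to
-- v₀ by (leafMults !! j) parallel edges.
bananaStar : (k : ℕ) → Vector ℕ k → Vector ℕ k → Multigraph
bananaStar k a r = record
  { n     = suc N
  ; edges = concat (tabulate {n = N}
              (λ j → replicate (lookup ms j) (Fin.zero , Fin.suc j)))
  }
  where
    ms = leafMults k a r
    N  = length ms

prefixSum : (k : ℕ) → Vector ℕ k → Fin k → ℕ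
prefixSum k r ℓ = sum (map r (filter (λ i → i Fin.≤? ℓ) (allFin k)))

bananaBound : (k : ℕ) → Vector ℕ k → Vector ℕ k → ℕ
bananaBound k a r =
  foldr _⊔_ 0 (map (λ ℓ → a ℓ ⊓ (1 + prefixSum k r ℓ)) (allFin k))

-- Write c(t) for the number of leaves joined to the centre by at least t edges, and
-- H(t) for the centre together with these leaves.  If a scramble has order o and H(o)
-- misses some egg, that egg is a single leaf of multiplicity < o; either this leaf meets
-- every egg (so o ≤ 1) or its edges form an egg-cut of size < o.  Hence o ≤ 1 + c(o).
-- Conversely, when some leaf has multiplicity ≥ t, the singletons of H(t) form a
-- scramble of hitting number 1 + c(t) and egg-cut number the least multiplicity ≥ t.
-- So sn(G) is the largest t with t ≤ 1 + c(t).  As a is decreasing, c(t) = r₁ + ⋯ + r_ℓ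
-- for the last ℓ with a_ℓ ≥ t, which identifies that t with max_ℓ min(a_ℓ, 1 + r₁ + ⋯ + r_ℓ).

module Submission where

open import Defs
open import Data.Nat using (ℕ; _≤_; _<_)
open import Data.Fin using (Fin) renaming (_<_ to _<ᶠ_)
open import Data.Vec.Functional using (Vector)

open import Data.Nat using (suc; _+_; _⊓_; _⊔_; z≤n; s≤s)
open import Data.Nat.Properties
open import Data.Nat.ListAction using (sum)
import Data.Fin as F
import Data.Fin.Properties as FP
open import Data.Fin.Subset using (Subset; inside; _∈_; _∉_; _⊆_; ∣_∣; ⁅_⁆)
open import Data.Fin.Subset.Properties using (_∈?_; x∈⁅x⁆; x∈⁅y⁆⇒x≡y; ∣⁅x⁆∣≡1; p⊆q⇒∣p∣≤∣q∣; drop-there)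
import Data.Vec as V
import Data.Vec.Properties as VP
open import Data.List using (List; []; _∷_; _++_; length; map; filter; concat; replicate; tabulate; lookup; allFin; foldr)
open import Data.List.Properties using (filter-++; length-++; filter-all; filter-none; length-replicate; foldr-forcesᵇ; map-tabulate)
open import Data.List.Relation.Unary.All as All using (All)
open import Data.List.Relation.Unary.All.Properties using (replicate⁺; concat⁺; tabulate⁺; ¬All⇒Any¬)
open import Data.List.Relation.Unary.Any using (here; there)
open import Data.List.Membership.Propositional as LM using (find)
open import Data.List.Membership.Propositional.Properties using (∈-filter⁺; ∈-filter⁻; ∈-allFin; ∈-map⁺; ∈-map⁻; ∈-lookup; foldr-selective)
import Data.List.Extrema.Nat as Extrema
open import Data.Product using (∃; ∃₂; ∃-syntax; _×_; _,_; proj₁; proj₂)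
open import Data.Product.Properties using (≡-dec)
open import Data.Sum using (_⊎_; inj₁; inj₂)
open import Data.Maybe using (just; nothing)
open import Function using (_∘_; id)
open import Function.Definitions using (Injective)
open import Level using (0ℓ)
open import Relation.Nullary using (¬_; ¬?; Dec; yes; no; does; proof; Reflects; invert; contradiction; _×-dec_)
open import Relation.Nullary.Decidable using (dec-true; decidable-stable)
open import Relation.Unary using (Pred; Decidable)
open import Relation.Binary.Definitions using (DecidableEquality)
open import Relation.Binary.PropositionalEquality

private
  variable
    A I : Set

sumWhere : {P : Pred A 0ℓ} → Decidable P → (A → ℕ) → List A → ℕ
sumWhere P? w xs = sum (map w (filter P? xs))

module _ {A : Set} {P : Pred A 0ℓ} (P? : Decidable P) (w : A → ℕ) where

  sumWhere-mono : {Q : Pred A 0ℓ} (Q? : Decidable Q) → (∀ {x} → P x → Q x) → ∀ xs →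
                  sumWhere P? w xs ≤ sumWhere Q? w xs
  sumWhere-mono Q? P⇒Q [] = z≤n
  sumWhere-mono Q? P⇒Q (x ∷ xs) with P? x | Q? x
  ... | yes _  | yes _  = +-monoʳ-≤ (w x) (sumWhere-mono Q? P⇒Q xs)
  ... | yes px | no ¬qx = contradiction (P⇒Q px) ¬qx
  ... | no _   | yes _  = ≤-trans (sumWhere-mono Q? P⇒Q xs) (m≤n+m _ (w x))
  ... | no _   | no _   = sumWhere-mono Q? P⇒Q xs

  ≤-sumWhere : ∀ {x xs} → x LM.∈ xs → P x → w x ≤ sumWhere P? w xs
  ≤-sumWhere {xs = y ∷ xs} x∈ px with P? y | x∈
  ... | yes _  | here refl   = m≤m+n (w y) _
  ... | no ¬py | here refl   = contradiction px ¬py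
  ... | yes _  | there x∈xs = ≤-trans (≤-sumWhere x∈xs px) (m≤n+m _ (w y))
  ... | no _   | there x∈xs = ≤-sumWhere x∈xs px

  sumWhere-none : (∀ x → ¬ P x) → ∀ xs → sumWhere P? w xs ≡ 0
  sumWhere-none ¬P xs = cong (sum ∘ map w) (filter-none P? (All.universal ¬P xs))

module _ {A : Set} {P : Pred A 0ℓ} (P? : Decidable P) where

  length-filter-++ : ∀ xs ys → length (filter P? (xs ++ ys)) ≡ length (filter P? xs) + length (filter P? ys)
  length-filter-++ xs ys = trans (cong length (filter-++ P? xs ys)) (length-++ (filter P? xs))

  length-filter-replicate-accept : ∀ n {x} → P x → length (filter P? (replicate n x)) ≡ n
  length-filter-replicate-accept n px = trans (cong length (filter-all P? (replicate⁺ n px))) (length-replicate n)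

  length-filter-replicate-reject : ∀ n {x} → ¬ P x → length (filter P? (replicate n x)) ≡ 0
  length-filter-replicate-reject n ¬px = cong length (filter-none P? (replicate⁺ n ¬px))

  length-filter-concat-replicate : (w : I → ℕ) (v : I → A) (is : List I) →
    length (filter P? (concat (map (λ i → replicate (w i) (v i)) is))) ≡ sumWhere (P? ∘ v) w is
  length-filter-concat-replicate w v [] = refl
  length-filter-concat-replicate w v (i ∷ is) with P? (v i)
  ... | yes pvi = trans (length-filter-++ (replicate (w i) (v i)) (concat (map (λ i → replicate (w i) (v i)) is)))
                        (cong₂ _+_ (length-filter-replicate-accept (w i) pvi) (length-filter-concat-replicate w v is))
  ... | no ¬pvi = trans (length-filter-++ (replicate (w i) (v i)) (concat (map (λ i → replicate (w i) (v i)) is)))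
                        (cong₂ _+_ (length-filter-replicate-reject (w i) ¬pvi) (length-filter-concat-replicate w v is))

  length-filter-pos⇒lookup : ∀ xs → 0 < length (filter P? xs) → ∃[ j ] P (lookup xs j)
  length-filter-pos⇒lookup (x ∷ xs) pos with P? x
  ... | yes px = F.zero , px
  ... | no _   = let j , pj = length-filter-pos⇒lookup xs pos in F.suc j , pj

All-concat-replicate : ∀ {n} {R : Pred A 0ℓ} (w : Fin n → ℕ) (g : Fin n → A) →
  (∀ j → R (g j)) → All R (concat (tabulate (λ j → replicate (w j) (g j))))
All-concat-replicate w g Rg = concat⁺ (tabulate⁺ (λ j → replicate⁺ (w j) (Rg j)))

module _ {A : Set} (_≟_ : DecidableEquality A) where

  length-filter-≟-concat-replicate : ∀ {n} (w : Fin n → ℕ) (g : Fin n → A) → Injective _≡_ _≡_ g →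
    ∀ x → length (filter (_≟ g x) (concat (tabulate (λ j → replicate (w j) (g j))))) ≡ w x
  length-filter-≟-concat-replicate {suc n} w g g-inj x =
    trans (length-filter-++ (_≟ g x) (replicate (w F.zero) (g F.zero)) rest) (split x)
    where
    rest : List A
    rest = concat (tabulate (λ j → replicate (w (F.suc j)) (g (F.suc j))))
    split : ∀ x → length (filter (_≟ g x) (replicate (w F.zero) (g F.zero))) +
                  length (filter (_≟ g x) rest) ≡ w x
    split F.zero = trans
      (cong₂ _+_ (length-filter-replicate-accept (_≟ g F.zero) (w F.zero) refl)
                 (cong length (filter-none (_≟ g F.zero)
                   (All-concat-replicate (w ∘ F.suc) (g ∘ F.suc) (λ j → FP.0≢1+n ∘ sym ∘ g-inj)))))
      (+-identityʳ (w F.zero))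
    split (F.suc x) = cong₂ _+_
      (length-filter-replicate-reject (_≟ g (F.suc x)) (w F.zero) (FP.0≢1+n ∘ g-inj))
      (length-filter-≟-concat-replicate (w ∘ F.suc) (g ∘ F.suc) (FP.suc-injective ∘ g-inj) x)

module _ (f : A → ℕ) where

  ≤-foldr-⊔ : ∀ {x xs} → x LM.∈ xs → f x ≤ foldr _⊔_ 0 (map f xs)
  ≤-foldr-⊔ {xs = xs} x∈xs = All.lookup all≤ (∈-map⁺ f x∈xs)
    where
    all≤ : All (_≤ foldr _⊔_ 0 (map f xs)) (map f xs)
    all≤ = foldr-forcesᵇ (λ m n m⊔n≤ → m⊔n≤o⇒m≤o m n m⊔n≤ , m⊔n≤o⇒n≤o m n m⊔n≤) 0 (map f xs) ≤-refl

  foldr-⊔-attained : ∀ {x xs} → x LM.∈ xs → ∃[ y ] foldr _⊔_ 0 (map f xs) ≡ f y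
  foldr-⊔-attained {x} {xs} x∈xs with foldr-selective ⊔-sel 0 (map f xs)
  ... | inj₁ max≡0 = x , trans max≡0 (sym (n≤0⇒n≡0 (subst (f x ≤_) max≡0 (≤-foldr-⊔ x∈xs))))
  ... | inj₂ max∈  = let y , _ , max≡fy = ∈-map⁻ f max∈ in y , max≡fy

minimiser : ∀ {n} {P : Pred (Fin n) 0ℓ} → Decidable P → (f : Fin n → ℕ) → ∃ P →
            ∃[ y ] P y × (∀ z → P z → f y ≤ f z)
minimiser {n} {P} P? f (x , px) = y , py , y-min
  where
  candidates : List (Fin n)
  candidates = filter P? (allFin n)
  y : Fin n
  y = Extrema.argmin f x candidates
  py : P y
  py with Extrema.argmin-sel f x candidates
  ... | inj₁ y≡x = subst P (sym y≡x) px
  ... | inj₂ y∈  = proj₂ (∈-filter⁻ P? {xs = allFin n} y∈)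
  y-min : ∀ z → P z → f y ≤ f z
  y-min z pz = All.lookup (Extrema.f[argmin]≤f[xs] x candidates) (∈-filter⁺ P? (∈-allFin z) pz)

toSubset : ∀ {n} {P : Pred (Fin n) 0ℓ} → Decidable P → Subset n
toSubset P? = V.tabulate (does ∘ P?)

module _ {n} {P : Pred (Fin n) 0ℓ} (P? : Decidable P) where

  ∈-toSubset⁺ : ∀ {x} → P x → x ∈ toSubset P?
  ∈-toSubset⁺ {x} px =
    VP.lookup⇒[]= x (toSubset P?) (trans (VP.lookup∘tabulate (does ∘ P?) x) (dec-true (P? x) px))

  ∈-toSubset⁻ : ∀ {x} → x ∈ toSubset P? → P x
  ∈-toSubset⁻ {x} x∈ = invert (subst (Reflects (P x)) does≡inside (proof (P? x)))
    where
    does≡inside : does (P? x) ≡ inside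
    does≡inside = trans (sym (VP.lookup∘tabulate (does ∘ P?) x)) (VP.[]=⇒lookup x∈)

∣toSubset∘lookup∣ : {P : Pred A 0ℓ} (P? : Decidable P) (xs : List A) →
                    ∣ toSubset (P? ∘ lookup xs) ∣ ≡ length (filter P? xs)
∣toSubset∘lookup∣ P? []       = refl
∣toSubset∘lookup∣ P? (x ∷ xs) with P? x
... | yes _ = cong suc (∣toSubset∘lookup∣ P? xs)
... | no _  = ∣toSubset∘lookup∣ P? xs

module _ {G : Multigraph} where

  walk-start : ∀ {keep inW u v} → Walk G keep inW u v → inW u
  walk-start (here inWu)           = inWu
  walk-start (step _ _ _ inWu _)   = inWu

  _++ʷ_ : ∀ {keep inW u v w} → Walk G keep inW u v → Walk G keep inW v w → Walk G keep inW u w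
  here _                ++ʷ q = q
  step e ke joins inWu p ++ʷ q = step e ke joins inWu (p ++ʷ q)

  walk-map : ∀ {keep keep′ : Fin (m G) → Set} {inW inW′ : Fin (n G) → Set} {u v} →
    (∀ {e x y} → keep e → Joins G e x y → inW x → inW y → keep′ e) →
    (∀ {x} → inW x → inW′ x) →
    Walk G keep inW u v → Walk G keep′ inW′ u v
  walk-map keep⇒ inW⇒ (here inWu) = here (inW⇒ inWu)
  walk-map keep⇒ inW⇒ (step e ke joins inWu rest) =
    step e (keep⇒ ke joins inWu (walk-start rest)) joins (inW⇒ inWu) (walk-map keep⇒ inW⇒ rest)

  walk-⁅⁆ : ∀ {keep inW v x y} → inW v → x ∈ ⁅ v ⁆ → y ∈ ⁅ v ⁆ → Walk G keep inW x y
  walk-⁅⁆ {v = v} inWv x∈ y∈ rewrite x∈⁅y⁆⇒x≡y v x∈ | x∈⁅y⁆⇒x≡y v y∈ = here inWv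

  min∞≤ : ∀ h c → min∞ h c ≤ h
  min∞≤ h (just c) = m⊓n≤m h c
  min∞≤ h nothing  = ≤-refl

  order≤∣hittingSet∣ : ∀ {S o X} → Order G S o → Hits G S X → o ≤ ∣ X ∣
  order≤∣hittingSet∣ {X = X} (h , c , (_ , h-min) , _ , refl) hits =
    ≤-trans (min∞≤ h c) (h-min ∣ X ∣ (X , hits , refl))

  order≤∣eggCut∣ : ∀ {S o T} → Order G S o → IsEggCut G S T → o ≤ ∣ T ∣
  order≤∣eggCut∣ {T = T} (_ , nothing , _ , noCut , _) cut = contradiction (T , cut) noCut
  order≤∣eggCut∣ {T = T} (h , just c , _ , (_ , c-min) , refl) cut =
    ≤-trans (m⊓n≤n h c) (c-min ∣ T ∣ (T , cut , refl))

  singletonEggs : VertexSet G → List (VertexSet G)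
  singletonEggs X = map ⁅_⁆ (filter (_∈? X) (allFin (n G)))

  module _ {X : VertexSet G} where

    ∈-singletonEggs⁺ : ∀ {v} → v ∈ X → ⁅ v ⁆ LM.∈ singletonEggs X
    ∈-singletonEggs⁺ {v} v∈X = ∈-map⁺ ⁅_⁆ (∈-filter⁺ (_∈? X) (∈-allFin v) v∈X)

    ∈-singletonEggs⁻ : ∀ {E} → E LM.∈ singletonEggs X → ∃[ v ] v ∈ X × E ≡ ⁅ v ⁆
    ∈-singletonEggs⁻ E∈ =
      let v , v∈ , E≡ = ∈-map⁻ ⁅_⁆ E∈
      in  v , proj₂ (∈-filter⁻ (_∈? X) {xs = allFin (n G)} v∈) , E≡

  singletons : VertexSet G → Scramble G
  singletons X = record { eggs = singletonEggs X ; isEggs = All.tabulate isEgg }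
    where
    isEgg : ∀ {E} → E LM.∈ singletonEggs X → IsEgg G E
    isEgg E∈ with ∈-singletonEggs⁻ E∈
    ... | v , _ , refl = (v , x∈⁅x⁆ v) , λ _ _ → walk-⁅⁆ (x∈⁅x⁆ v)

  hittingNumber-singletons : ∀ X → HittingNumber G (singletons X) ∣ X ∣
  hittingNumber-singletons X = (X , hitsX , refl) , λ { _ (H , hitsH , refl) → p⊆q⇒∣p∣≤∣q∣ (X⊆ hitsH) }
    where
    hitsX : Hits G (singletons X) X
    hitsX = All.tabulate λ E∈ → hit (∈-singletonEggs⁻ E∈)
      where
      hit : ∀ {E} → ∃[ v ] v ∈ X × E ≡ ⁅ v ⁆ → ∃[ x ] x ∈ X × x ∈ E
      hit (v , v∈X , refl) = v , v∈X , x∈⁅x⁆ v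
    X⊆ : ∀ {H} → Hits G (singletons X) H → X ⊆ H
    X⊆ {H} hitsH {v} v∈X =
      let x , x∈H , x∈⁅v⁆ = All.lookup hitsH (∈-singletonEggs⁺ v∈X)
      in  subst (_∈ H) (x∈⁅y⁆⇒x≡y v x∈⁅v⁆) x∈H

  module _ {X : VertexSet G} {T : EdgeSet G} where

    isEggCut-singletons⁺ : ∀ {u w} → u ∈ X → w ∈ X → ¬ SameComp G T u w →
                           IsEggCut G (singletons X) T
    isEggCut-singletons⁺ {u} {w} u∈X w∈X apart =
      ⁅ u ⁆ , ⁅ w ⁆ , ∈-singletonEggs⁺ u∈X , ∈-singletonEggs⁺ w∈X ,
      (λ _ _ → walk-⁅⁆ refl) , (λ _ _ → walk-⁅⁆ refl) ,
      λ x y x∈ y∈ → apart ∘ subst₂ (SameComp G T) (x∈⁅y⁆⇒x≡y u x∈) (x∈⁅y⁆⇒x≡y w y∈)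

    isEggCut-singletons⁻ : IsEggCut G (singletons X) T →
                           ∃₂ λ u w → u ∈ X × w ∈ X × ¬ SameComp G T u w
    isEggCut-singletons⁻ (_ , _ , E₁∈ , E₂∈ , _ , _ , apart)
      with ∈-singletonEggs⁻ E₁∈ | ∈-singletonEggs⁻ E₂∈
    ... | u , u∈X , refl | w , w∈X , refl = u , w , u∈X , w∈X , apart u w (x∈⁅x⁆ u) (x∈⁅x⁆ w)

-- bananaStar k a r unfolds to starGraph (leafMults k a r).
starGraph : List ℕ → Multigraph
starGraph ms = record
  { n     = suc (length ms)
  ; edges = concat (tabulate (λ j → replicate (lookup ms j) (F.zero , F.suc j)))
  }

module StarGraph (ms : List ℕ) where

  G : Multigraph
  G = starGraph ms

  N : ℕ
  N = length ms

  spoke : Fin N → Fin (suc N) × Fin (suc N)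
  spoke j = F.zero , F.suc j

  _≟ᵉ_ : DecidableEquality (Fin (suc N) × Fin (suc N))
  _≟ᵉ_ = ≡-dec F._≟_ F._≟_

  edgesAt : Fin N → EdgeSet G
  edgesAt j = toSubset (λ e → endpoints G e ≟ᵉ spoke j)

  ∣edgesAt∣ : ∀ j → ∣ edgesAt j ∣ ≡ lookup ms j
  ∣edgesAt∣ j = trans (∣toSubset∘lookup∣ (_≟ᵉ spoke j) (edges G))
                      (length-filter-≟-concat-replicate _≟ᵉ_ (lookup ms) spoke (FP.suc-injective ∘ cong proj₂) j)

  endpoints-spoke : ∀ e → ∃[ j ] endpoints G e ≡ spoke j
  endpoints-spoke e = All.lookup (All-concat-replicate {R = λ p → ∃[ j ] p ≡ spoke j} (lookup ms) spoke (λ j → j , refl))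
                                 (∈-lookup e)

  ∈-edgesAt⁺ : ∀ {e j} → endpoints G e ≡ spoke j → e ∈ edgesAt j
  ∈-edgesAt⁺ {e} {j} = ∈-toSubset⁺ (λ e → endpoints G e ≟ᵉ spoke j)

  ∈-edgesAt⁻ : ∀ {e j} → e ∈ edgesAt j → endpoints G e ≡ spoke j
  ∈-edgesAt⁻ {e} {j} = ∈-toSubset⁻ (λ e → endpoints G e ≟ᵉ spoke j)

  joins-spoke : ∀ {e j u w} → endpoints G e ≡ spoke j → Joins G e u w →
                (u ≡ F.zero × w ≡ F.suc j) ⊎ (u ≡ F.suc j × w ≡ F.zero)
  joins-spoke e≡ (inj₁ (p₁ , p₂)) = inj₁ (trans (sym p₁) (cong proj₁ e≡) , trans (sym p₂) (cong proj₂ e≡))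
  joins-spoke e≡ (inj₂ (p₁ , p₂)) = inj₂ (trans (sym p₂) (cong proj₂ e≡) , trans (sym p₁) (cong proj₁ e≡))

  joins-leaf : ∀ {e j w} → Joins G e (F.suc j) w → w ≡ F.zero × e ∈ edgesAt j
  joins-leaf {e} joins with endpoints-spoke e
  ... | i , e≡ with joins-spoke e≡ joins
  ...   | inj₁ (j≡0 , _)      = contradiction (sym j≡0) FP.0≢1+n
  ...   | inj₂ (refl , w≡0)   = w≡0 , ∈-edgesAt⁺ e≡

  edgesAt-isolate : ∀ {T j v} → edgesAt j ⊆ T → SameComp G T (F.suc j) v → v ≡ F.suc j
  edgesAt-isolate _   (here _)                 = refl
  edgesAt-isolate cut (step _ e∉T joins _ _)   = contradiction (cut (proj₂ (joins-leaf joins))) e∉T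

  egg-leaf : ∀ {keep E j y} → F.zero ∉ E → Walk G keep (_∈ E) (F.suc j) y → y ≡ F.suc j
  egg-leaf 0∉E (here _)                = refl
  egg-leaf 0∉E (step _ _ joins _ rest) =
    contradiction (subst (_∈ _) (proj₁ (joins-leaf joins)) (walk-start rest)) 0∉E

  walk-avoiding-leaf : ∀ {E j u v} → F.suc j ∉ E → Walk G (AllEdges G) (_∈ E) u v → SameComp G (edgesAt j) u v
  walk-avoiding-leaf {E} {j} j∉E = walk-map avoids (λ _ → refl)
    where
    avoids : ∀ {e x y} → AllEdges G e → Joins G e x y → x ∈ E → y ∈ E → e ∉ edgesAt j
    avoids _ joins x∈ y∈ e∈ with joins-spoke (∈-edgesAt⁻ e∈) joins
    ... | inj₁ (_ , y≡j) = j∉E (subst (_∈ E) y≡j y∈)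
    ... | inj₂ (x≡j , _) = j∉E (subst (_∈ E) x≡j x∈)

  CutOff : EdgeSet G → Fin (suc N) → Set
  CutOff T v = ∃[ j ] v ≡ F.suc j × edgesAt j ⊆ T

  cutOff⊎attached : ∀ T v → CutOff T v ⊎ (SameComp G T v F.zero × SameComp G T F.zero v)
  cutOff⊎attached T F.zero = inj₂ (here refl , here refl)
  cutOff⊎attached T (F.suc j) with FP.any? (λ e → (e ∈? edgesAt j) ×-dec ¬? (e ∈? T))
  ... | yes (e , e∈ , e∉T) = inj₂ (step e e∉T (inj₂ spoke-ends) refl (here refl) ,
                                   step e e∉T (inj₁ spoke-ends) refl (here refl))
    where
    spoke-ends : proj₁ (endpoints G e) ≡ F.zero × proj₂ (endpoints G e) ≡ F.suc j
    spoke-ends = cong proj₁ (∈-edgesAt⁻ e∈) , cong proj₂ (∈-edgesAt⁻ e∈)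
  ... | no none = inj₁ (j , refl , λ {e} e∈ → decidable-stable (e ∈? T) (λ e∉T → none (e , e∈ , e∉T)))

  separated⇒cutOff : ∀ {T u w} → ¬ SameComp G T u w → CutOff T u ⊎ CutOff T w
  separated⇒cutOff {T} {u} {w} apart with cutOff⊎attached T u | cutOff⊎attached T w
  ... | inj₁ u-cut       | _                = inj₁ u-cut
  ... | inj₂ _           | inj₁ w-cut       = inj₂ w-cut
  ... | inj₂ (u→0 , _)   | inj₂ (_ , 0→w)   = contradiction (u→0 ++ʷ 0→w) apart

  heavyCount : ℕ → ℕ
  heavyCount t = length (filter (t ≤?_) ms)

  heavy : ℕ → VertexSet G
  heavy t = inside V.∷ toSubset (λ j → t ≤? lookup ms j)

  ∣heavy∣ : ∀ t → ∣ heavy t ∣ ≡ suc (heavyCount t)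
  ∣heavy∣ t = cong suc (∣toSubset∘lookup∣ (t ≤?_) ms)

  ∈-heavy⁺ : ∀ {t j} → t ≤ lookup ms j → F.suc j ∈ heavy t
  ∈-heavy⁺ {t} = V.there ∘ ∈-toSubset⁺ (λ j → t ≤? lookup ms j)

  ∈-heavy⁻ : ∀ {t j} → F.suc j ∈ heavy t → t ≤ lookup ms j
  ∈-heavy⁻ {t} = ∈-toSubset⁻ (λ j → t ≤? lookup ms j) ∘ drop-there

  Meets : VertexSet G → VertexSet G → Set
  Meets X E = ∃[ x ] x ∈ X × x ∈ E

  meets? : ∀ X E → Dec (Meets X E)
  meets? X E = FP.any? (λ x → (x ∈? X) ×-dec (x ∈? E))

  egg-missing-heavy : ∀ {t E} → IsEgg G E → ¬ Meets (heavy t) E →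
                      ∃[ j ] lookup ms j < t × F.suc j ∈ E × (∀ y → y ∈ E → y ≡ F.suc j)
  egg-missing-heavy ((F.zero , 0∈E) , _) missed = contradiction (F.zero , V.here , 0∈E) missed
  egg-missing-heavy {t} {E} ((F.suc j , j∈E) , connected) missed with t ≤? lookup ms j
  ... | yes heavy-j = contradiction (F.suc j , ∈-heavy⁺ heavy-j , j∈E) missed
  ... | no  light-j = j , ≰⇒> light-j , j∈E ,
                      λ y y∈E → egg-leaf (λ 0∈E → missed (F.zero , V.here , 0∈E)) (connected (F.suc j) y j∈E y∈E)

  edgesAt-eggCut : ∀ {S : Scramble G} {E₁ E₂ j} → E₁ LM.∈ eggs S → E₂ LM.∈ eggs S →
                   (∀ y → y ∈ E₁ → y ≡ F.suc j) → F.suc j ∉ E₂ → IsEggCut G S (edgesAt j)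
  edgesAt-eggCut {S} {E₁} {E₂} {j} E₁∈ E₂∈ E₁≡j j∉E₂ =
    E₁ , E₂ , E₁∈ , E₂∈ , within₁ , within₂ , apart
    where
    within₁ : ∀ x y → x ∈ E₁ → y ∈ E₁ → SameComp G (edgesAt j) x y
    within₁ x y x∈ y∈ rewrite E₁≡j x x∈ | E₁≡j y y∈ = here refl
    within₂ : ∀ x y → x ∈ E₂ → y ∈ E₂ → SameComp G (edgesAt j) x y
    within₂ x y x∈ y∈ = walk-avoiding-leaf j∉E₂ (proj₂ (All.lookup (isEggs S) E₂∈) x y x∈ y∈)
    apart : ∀ x y → x ∈ E₁ → y ∈ E₂ → ¬ SameComp G (edgesAt j) x y
    apart x y x∈ y∈ x~y rewrite E₁≡j x x∈ = j∉E₂ (subst (_∈ E₂) (edgesAt-isolate (λ e∈ → e∈) x~y) y∈)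

  hits-or-cut : ∀ (S : Scramble G) t →
                Hits G S (heavy t) ⊎ (∃[ v ] Hits G S ⁅ v ⁆) ⊎ (∃[ T ] IsEggCut G S T × ∣ T ∣ < t)
  hits-or-cut S t with All.all? (meets? (heavy t)) (eggs S)
  ... | yes hits    = inj₁ hits
  ... | no  ¬hits   with find (¬All⇒Any¬ (meets? (heavy t)) (eggs S) ¬hits)
  ...   | E , E∈ , missed with egg-missing-heavy (All.lookup (isEggs S) E∈) missed
  ...     | j , light-j , j∈E , E≡j with All.all? (F.suc j ∈?_) (eggs S)
  ...       | yes j∈all = inj₂ (inj₁ (F.suc j , All.map (λ j∈ → F.suc j , x∈⁅x⁆ (F.suc j) , j∈) j∈all))
  ...       | no  ¬j∈all =
    let E₂ , E₂∈ , j∉E₂ = find (¬All⇒Any¬ (F.suc j ∈?_) (eggs S) ¬j∈all)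
    in  inj₂ (inj₂ (edgesAt j , edgesAt-eggCut {S} E∈ E₂∈ E≡j j∉E₂ , subst (_< t) (sym (∣edgesAt∣ j)) light-j))

  order≤1+heavyCount : ∀ {S o} → Order G S o → o ≤ suc (heavyCount o)
  order≤1+heavyCount {S} {o} ord with hits-or-cut S o
  ... | inj₁ hits                    = subst (o ≤_) (∣heavy∣ o) (order≤∣hittingSet∣ ord hits)
  ... | inj₂ (inj₁ (v , hits))       = ≤-trans (subst (o ≤_) (∣⁅x⁆∣≡1 v) (order≤∣hittingSet∣ ord hits)) (s≤s z≤n)
  ... | inj₂ (inj₂ (T , cut , ∣T∣<o)) = contradiction (order≤∣eggCut∣ ord cut) (<⇒≱ ∣T∣<o)

  module _ {t : ℕ} (heavy-leaf : ∃[ j ] t ≤ lookup ms j) where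

    lightest : ∃[ x ] t ≤ lookup ms x × (∀ j → t ≤ lookup ms j → lookup ms x ≤ lookup ms j)
    lightest = minimiser (λ j → t ≤? lookup ms j) (lookup ms) heavy-leaf

    lightestLeaf : Fin N
    lightestLeaf = proj₁ lightest

    eggCutNumber-heavy : EggCutNumber G (singletons (heavy t)) (just (lookup ms lightestLeaf))
    eggCutNumber-heavy = (edgesAt lightestLeaf , cut* , ∣edgesAt∣ lightestLeaf) , λ { _ (T , cut , refl) → minimal cut }
      where
      cut* : IsEggCut G (singletons (heavy t)) (edgesAt lightestLeaf)
      cut* = isEggCut-singletons⁺ (∈-heavy⁺ (proj₁ (proj₂ lightest))) V.here
               (FP.0≢1+n ∘ edgesAt-isolate (λ e∈ → e∈))
      bound : ∀ {T j} → F.suc j ∈ heavy t → edgesAt j ⊆ T → lookup ms lightestLeaf ≤ ∣ T ∣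
      bound {T} {j} j∈ edges⊆T = begin
        lookup ms lightestLeaf ≤⟨ proj₂ (proj₂ lightest) j (∈-heavy⁻ j∈) ⟩
        lookup ms j  ≡⟨ ∣edgesAt∣ j ⟨
        ∣ edgesAt j ∣ ≤⟨ p⊆q⇒∣p∣≤∣q∣ edges⊆T ⟩
        ∣ T ∣        ∎
        where open ≤-Reasoning
      minimal : ∀ {T} → IsEggCut G (singletons (heavy t)) T → lookup ms lightestLeaf ≤ ∣ T ∣
      minimal cut with isEggCut-singletons⁻ cut
      ... | u , w , u∈ , w∈ , apart with separated⇒cutOff apart
      ...   | inj₁ (j , refl , edges⊆T) = bound u∈ edges⊆T
      ...   | inj₂ (j , refl , edges⊆T) = bound w∈ edges⊆T

    order-heavy : t ≤ suc (heavyCount t) → ∃[ o ] Order G (singletons (heavy t)) o × t ≤ o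
    order-heavy t≤ =
      ∣ heavy t ∣ ⊓ lookup ms lightestLeaf ,
      (∣ heavy t ∣ , just (lookup ms lightestLeaf) , hittingNumber-singletons {G = G} (heavy t) , eggCutNumber-heavy , refl) ,
      ⊓-glb (subst (t ≤_) (sym (∣heavy∣ t)) t≤) (proj₁ (proj₂ lightest))

  scrambleNumber-starGraph : ∀ B → B ≤ suc (heavyCount B) → 0 < heavyCount B →
                             (∀ t → t ≤ suc (heavyCount t) → t ≤ B) → ScrambleNumber G B
  scrambleNumber-starGraph B B≤ heavy-B maximal
    with order-heavy (length-filter-pos⇒lookup (B ≤?_) ms heavy-B) B≤
  ... | o , ord , B≤o =
    subst (λ o → ∃[ S ] Order G S o) (≤-antisym (order≤B ord) B≤o) (singletons (heavy B) , ord) ,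
    λ _ (_ , ord) → order≤B ord
    where
    order≤B : ∀ {S o} → Order G S o → o ≤ B
    order≤B ord = maximal _ (order≤1+heavyCount ord)

module BananaArithmetic {k : ℕ} (a r : Vector ℕ k) where

  weightAbove : ℕ → ℕ
  weightAbove t = sumWhere (λ i → t ≤? a i) r (allFin k)

  length-filter-leafMults : ∀ t → length (filter (t ≤?_) (leafMults k a r)) ≡ weightAbove t
  length-filter-leafMults t =
    trans (cong (length ∘ filter (t ≤?_) ∘ concat) (sym (map-tabulate id (λ i → replicate (r i) (a i)))))
          (length-filter-concat-replicate (t ≤?_) r a (allFin k))

  term : Fin k → ℕ
  term ℓ = a ℓ ⊓ (1 + prefixSum k r ℓ)

  term≤bananaBound : ∀ ℓ → term ℓ ≤ bananaBound k a r
  term≤bananaBound ℓ = ≤-foldr-⊔ term (∈-allFin ℓ)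

  bananaBound-attained : 1 ≤ k → ∃[ ℓ ] bananaBound k a r ≡ term ℓ
  bananaBound-attained k≥1 = foldr-⊔-attained term (∈-allFin (F.fromℕ< k≥1))

  module _ (decreasing : ∀ (i j : Fin k) → i <ᶠ j → a j < a i) where

    i≤j⇒aⱼ≤aᵢ : ∀ {i j} → i F.≤ j → a j ≤ a i
    i≤j⇒aⱼ≤aᵢ {i} {j} i≤j with m≤n⇒m<n∨m≡n i≤j
    ... | inj₁ i<j = <⇒≤ (decreasing i j i<j)
    ... | inj₂ i≡j = ≤-reflexive (cong a (sym (FP.toℕ-injective i≡j)))

    aⱼ≤aᵢ⇒i≤j : ∀ {i j} → a j ≤ a i → i F.≤ j
    aⱼ≤aᵢ⇒i≤j {i} {j} aj≤ai = ≮⇒≥ (λ j<i → <⇒≱ (decreasing j i j<i) aj≤ai)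

    prefixSum≤weightAbove : ∀ {t ℓ} → t ≤ a ℓ → prefixSum k r ℓ ≤ weightAbove t
    prefixSum≤weightAbove {t} {ℓ} t≤aℓ =
      sumWhere-mono (F._≤? ℓ) r (λ i → t ≤? a i) (λ i≤ℓ → ≤-trans t≤aℓ (i≤j⇒aⱼ≤aᵢ i≤ℓ)) (allFin k)

    weightAbove≤prefixSum : ∀ {t ℓ} → (∀ i → t ≤ a i → a ℓ ≤ a i) → weightAbove t ≤ prefixSum k r ℓ
    weightAbove≤prefixSum {t} {ℓ} aℓ-least =
      sumWhere-mono (λ i → t ≤? a i) r (F._≤? ℓ) (λ {i} t≤ai → aⱼ≤aᵢ⇒i≤j (aℓ-least i t≤ai)) (allFin k)

    bananaBound≤1+weightAbove : 1 ≤ k → bananaBound k a r ≤ suc (weightAbove (bananaBound k a r))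
    bananaBound≤1+weightAbove k≥1 with bananaBound-attained k≥1
    ... | ℓ , B≡term = begin
      bananaBound k a r                        ≡⟨ B≡term ⟩
      term ℓ                                   ≤⟨ m⊓n≤n (a ℓ) _ ⟩
      suc (prefixSum k r ℓ)                    ≤⟨ s≤s (prefixSum≤weightAbove (subst (_≤ a ℓ) (sym B≡term) (m⊓n≤m _ _))) ⟩
      suc (weightAbove (bananaBound k a r))    ∎
      where open ≤-Reasoning

    weightAbove-bananaBound-pos : 1 ≤ k → (∀ i → 1 ≤ r i) → 0 < weightAbove (bananaBound k a r)
    weightAbove-bananaBound-pos k≥1 r-pos with bananaBound-attained k≥1
    ... | ℓ , B≡term = begin
      1                                        ≤⟨ r-pos ℓ ⟩
      r ℓ                                      ≤⟨ ≤-sumWhere (F._≤? ℓ) r (∈-allFin ℓ) (FP.≤-refl {x = ℓ}) ⟩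
      prefixSum k r ℓ                          ≤⟨ prefixSum≤weightAbove (subst (_≤ a ℓ) (sym B≡term) (m⊓n≤m _ _)) ⟩
      weightAbove (bananaBound k a r)          ∎
      where open ≤-Reasoning

    ≤-bananaBound : 1 ≤ k → (∀ i → 1 ≤ a i) → ∀ t → t ≤ suc (weightAbove t) → t ≤ bananaBound k a r
    ≤-bananaBound k≥1 a-pos t t≤ with FP.any? (λ i → t ≤? a i)
    ... | no none = begin
      t                    ≤⟨ subst (λ w → t ≤ suc w) (sumWhere-none (λ i → t ≤? a i) r (λ i → none ∘ (i ,_)) (allFin k)) t≤ ⟩
      1                    ≤⟨ ⊓-glb (a-pos ℓ₀) (s≤s z≤n) ⟩
      term ℓ₀              ≤⟨ term≤bananaBound ℓ₀ ⟩
      bananaBound k a r    ∎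
      where
      open ≤-Reasoning
      ℓ₀ : Fin k
      ℓ₀ = F.fromℕ< k≥1
    ... | yes some with minimiser (λ i → t ≤? a i) a some
    ...   | ℓ , t≤aℓ , aℓ-least = begin
      t                    ≤⟨ ⊓-glb t≤aℓ (≤-trans t≤ (s≤s (weightAbove≤prefixSum aℓ-least))) ⟩
      term ℓ               ≤⟨ term≤bananaBound ℓ ⟩
      bananaBound k a r    ∎
      where open ≤-Reasoning

proposition3p4 : (k : ℕ) (a r : Vector ℕ k) →
    1 ≤ k →
    (∀ (i j : Fin k) → i <ᶠ j → a j < a i) →
    (∀ i → 1 ≤ a i) →
    (∀ i → 1 ≤ r i) →
    ScrambleNumber (bananaStar k a r) (bananaBound k a r)
proposition3p4 k a r k≥1 decreasing a-pos r-pos =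
  scrambleNumber-starGraph B
    (subst (λ c → B ≤ suc c) (sym (length-filter-leafMults B)) (bananaBound≤1+weightAbove decreasing k≥1))
    (subst (0 <_) (sym (length-filter-leafMults B)) (weightAbove-bananaBound-pos decreasing k≥1 r-pos))
    (λ t → ≤-bananaBound decreasing k≥1 a-pos t ∘ subst (λ c → t ≤ suc c) (length-filter-leafMults t))
  where
  open StarGraph (leafMults k a r)
  open BananaArithmetic a r
  B : ℕ
  B = bananaBound k a r
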